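{- For all ultrafilters $\mathcal{U},\mathcal{V}$ on $\mathbb{N}$, if $\mathcal{U}\leq_{fe}\mathcal{V}\leq_{fe}\mathcal{U}\oplus1$, then $\mathcal{U}\equiv_{fe}\mathcal{V}$ or $\mathcal{U}\oplus1\equiv_{fe}\mathcal{V}$.
   Context: $\mathbb{N}=\{0,1,2,\dots\}$. For $A,B\subseteq\mathbb{N}$, $A\leq_{fe}B$ means that for every finite $F\subseteq A$ there is $k\in\mathbb{N}$ with $F+k\subseteq B$. For ultrafilters, $\mathcal{U}\leq_{fe}\mathcal{V}$ means that for every $B\in\mathcal{V}$ there is $A\in\mathcal{U}$ with $A\leq_{fe}B$; $\mathcal{U}\equiv_{fe}\mathcal{V}$ means $\mathcal{U}\leq_{fe}\mathcal{V}$ and $\mathcal{V}\leq_{fe}\mathcal{U}$. $\mathcal{U}\oplus1$ is the ultrafilter $\{A+1\mid A\in\mathcal{U}\}$ generates, i.e., $B\in\mathcal{U}\oplus1$ iff $\{n\mid n+1\in B\}\in\mathcal{U}$. -}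

module Defs where

open import Level using (0ℓ)
open import Data.Nat using (ℕ; suc; _+_)
open import Data.Product using (_×_; _,_; ∃)
open import Data.Sum using (_⊎_; inj₁; inj₂)
open import Data.List using (List)
open import Data.List.Relation.Unary.All using (All)
open import Relation.Nullary using (¬_)
open import Relation.Unary using (Pred; _⊆_; _∩_; ∅; ∁; U; _∈_)

Subset : Set₁
Subset = Pred ℕ 0ℓ

record Ultrafilter : Set₁ where
  field
    mem      : Subset → Set
    whole    : mem U
    no-empty : ¬ (mem ∅)
    upward   : ∀ {A B : Subset} → A ⊆ B → mem A → mem B
    meet     : ∀ {A B : Subset} → mem A → mem B → mem (A ∩ B)
    ultra    : ∀ (A : Subset) → mem A ⊎ mem (∁ A)

open Ultrafilter public

infix 4 _≤fe_ _≤feᵤ_ _≡feᵤ_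

-- A ≤fe B : every finite F ⊆ A has a translate F + k ⊆ B.
-- Finite subsets F are given by lists of their elements.
_≤fe_ : Subset → Subset → Set
A ≤fe B = ∀ (F : List ℕ) → All (λ n → n ∈ A) F → ∃ λ k → All (λ n → (n + k) ∈ B) F

_≤feᵤ_ : Ultrafilter → Ultrafilter → Set₁
𝒰 ≤feᵤ 𝒱 = ∀ (B : Subset) → mem 𝒱 B → ∃ λ (A : Subset) → mem 𝒰 A × A ≤fe B

_≡feᵤ_ : Ultrafilter → Ultrafilter → Set₁
𝒰 ≡feᵤ 𝒱 = (𝒰 ≤feᵤ 𝒱) × (𝒱 ≤feᵤ 𝒰)

shift : Subset → Subset
shift B n = B (suc n)

_⊕1 : Ultrafilter → Ultrafilter
𝒰 ⊕1 = record
  { mem      = λ B → mem 𝒰 (shift B)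
  ; whole    = upward 𝒰 (λ _ → _) (whole 𝒰)
  ; no-empty = λ p → no-empty 𝒰 (upward 𝒰 (λ ()) p)
  ; upward   = λ A⊆B p → upward 𝒰 A⊆B p
  ; meet     = λ p q → meet 𝒰 p q
  ; ultra    = λ A → ultra 𝒰 (shift A)
  }

-- Pick X ∈ 𝒰 containing no two consecutive numbers (one parity class). If X ∈ 𝒱, then for
-- B ∈ 𝒰 the hypothesis 𝒱 ≤fe 𝒰 ⊕ 1 yields A ∈ 𝒱 with A ∩ X ≤fe (B ∩ X) + 1; no element of
-- A ∩ X lies in (B ∩ X) + 1, so every translation used is positive and can be lowered by one,
-- giving A ∩ X ≤fe B, i.e. 𝒱 ≤fe 𝒰. If ∁ X ∈ 𝒱, then for C ∈ 𝒱 the hypothesis 𝒰 ≤fe 𝒱 yields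
-- A ∈ 𝒰 with A ∩ X ≤fe C ∖ X; again the translations are positive, so (A ∩ X) + 1 ≤fe C,
-- i.e. 𝒰 ⊕ 1 ≤fe 𝒱.
module Submission where

open import Defs
open import Data.Product using (_×_; _,_; proj₁; proj₂; ∃)
open import Data.Sum using (_⊎_; inj₁; inj₂)
open import Data.Nat using (zero; suc; _+_; pred; parity)
open import Data.Nat.Properties using (+-suc; +-identityʳ)
open import Data.Parity using (Parity; 0ℙ; 1ℙ)
open import Data.Parity.Properties using (p≢p⁻¹; suc-homo-⁻¹)
open import Data.List using ([]; _∷_; map)
open import Data.List.Relation.Unary.All using ([]; _∷_; head)
import Data.List.Relation.Unary.All as All
open import Data.List.Relation.Unary.All.Properties using (map⁺; map⁻)
open import Data.Empty using (⊥-elim)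
import Data.Empty as Empty
open import Relation.Binary.PropositionalEquality using (_≡_; refl; subst; sym; trans)
open import Relation.Unary using (_⊆_; _∩_; ∁; _⊥_)

-- shift (suc-image A) reduces to A, which is used silently below.
suc-image : Subset → Subset
suc-image A zero    = Empty.⊥
suc-image A (suc n) = A n

suc-image-mono : ∀ {A B : Subset} → A ⊆ B → suc-image A ⊆ suc-image B
suc-image-mono A⊆B {suc n} a = A⊆B a

suc-image-pred : ∀ {A : Subset} n → suc-image A n → A (pred n)
suc-image-pred (suc n) a = a

≤fe-monoˡ : ∀ {A A′ B : Subset} → A′ ⊆ A → A ≤fe B → A′ ≤fe B
≤fe-monoˡ A′⊆A A≤B F F⊆A′ = A≤B F (All.map A′⊆A F⊆A′)

≤fe-monoʳ : ∀ {A B B′ : Subset} → B ⊆ B′ → A ≤fe B → A ≤fe B′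
≤fe-monoʳ B⊆B′ A≤B F F⊆A with A≤B F F⊆A
... | k , F+k⊆B = k , All.map B⊆B′ F+k⊆B

-- A nonempty F ⊆ A cannot be translated by 0 into B, so the translation can be lowered by one.
disjoint-≤fe⇒≤fe-shift : ∀ {A B : Subset} → A ⊥ B → A ≤fe B → A ≤fe shift B
disjoint-≤fe⇒≤fe-shift A⊥B A≤B [] _ = 0 , []
disjoint-≤fe⇒≤fe-shift {B = B} A⊥B A≤B (x ∷ F) x∷F⊆A with A≤B (x ∷ F) x∷F⊆A
... | zero  , x+0∈B ∷ _ = ⊥-elim (A⊥B (head x∷F⊆A , subst B (+-identityʳ x) x+0∈B))
... | suc k , F+1+k⊆B  = k , All.map (λ {n} → subst B (+-suc n k)) F+1+k⊆B

≤fe-shift⇒suc-image-≤fe : ∀ {A B : Subset} → A ≤fe shift B → suc-image A ≤fe B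
≤fe-shift⇒suc-image-≤fe {A} {B} A≤shiftB F F⊆A+1
  with A≤shiftB (map pred F) (map⁺ (All.map (λ {n} → suc-image-pred n) F⊆A+1))
... | k , F-1+k⊆shiftB = k , All.zipWith translate (F⊆A+1 , map⁻ F-1+k⊆shiftB)
  where
  translate : ∀ {n} → suc-image A n × shift B (pred n + k) → B (n + k)
  translate {suc n} (_ , b) = b

≤feᵤ-⊕1⇒≤feᵤ : ∀ (𝒰 𝒱 : Ultrafilter) {X : Subset} → X ⊥ suc-image X →
               mem 𝒰 X → mem 𝒱 X → 𝒱 ≤feᵤ (𝒰 ⊕1) → 𝒱 ≤feᵤ 𝒰
≤feᵤ-⊕1⇒≤feᵤ 𝒰 𝒱 {X} X⊥X+1 X∈𝒰 X∈𝒱 𝒱≤𝒰⊕1 B B∈𝒰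
  with 𝒱≤𝒰⊕1 (suc-image (B ∩ X)) (meet 𝒰 B∈𝒰 X∈𝒰)
... | A , A∈𝒱 , A≤[B∩X]+1 =
  A ∩ X , meet 𝒱 A∈𝒱 X∈𝒱 ,
  ≤fe-monoʳ {B = B ∩ X} proj₁ (disjoint-≤fe⇒≤fe-shift A∩X⊥[B∩X]+1 A∩X≤[B∩X]+1)
  where
  A∩X≤[B∩X]+1 : (A ∩ X) ≤fe suc-image (B ∩ X)
  A∩X≤[B∩X]+1 = ≤fe-monoˡ {B = suc-image (B ∩ X)} proj₁ A≤[B∩X]+1

  A∩X⊥[B∩X]+1 : (A ∩ X) ⊥ suc-image (B ∩ X)
  A∩X⊥[B∩X]+1 {n} ((_ , n∈X) , n∈[B∩X]+1) = X⊥X+1 (n∈X , suc-image-mono proj₂ {n} n∈[B∩X]+1)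

≤feᵤ⇒⊕1-≤feᵤ : ∀ (𝒰 𝒱 : Ultrafilter) {X : Subset} →
               mem 𝒰 X → mem 𝒱 (∁ X) → 𝒰 ≤feᵤ 𝒱 → (𝒰 ⊕1) ≤feᵤ 𝒱
≤feᵤ⇒⊕1-≤feᵤ 𝒰 𝒱 {X} X∈𝒰 ∁X∈𝒱 𝒰≤𝒱 C C∈𝒱 with 𝒰≤𝒱 (C ∩ ∁ X) (meet 𝒱 C∈𝒱 ∁X∈𝒱)
... | A , A∈𝒰 , A≤C∖X =
  suc-image (A ∩ X) , meet 𝒰 A∈𝒰 X∈𝒰 ,
  ≤fe-shift⇒suc-image-≤fe {B = C} (≤fe-monoʳ {B = shift (C ∩ ∁ X)} proj₁
    (disjoint-≤fe⇒≤fe-shift A∩X⊥C∖X A∩X≤C∖X))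
  where
  A∩X≤C∖X : (A ∩ X) ≤fe (C ∩ ∁ X)
  A∩X≤C∖X = ≤fe-monoˡ {B = C ∩ ∁ X} proj₁ A≤C∖X

  A∩X⊥C∖X : (A ∩ X) ⊥ (C ∩ ∁ X)
  A∩X⊥C∖X ((_ , n∈X) , (_ , n∉X)) = n∉X n∈X

parity-class : Parity → Subset
parity-class p n = parity n ≡ p

parity-class-nonconsecutive : ∀ p → parity-class p ⊥ suc-image (parity-class p)
parity-class-nonconsecutive p {suc n} (n+1∈p , n∈p) =
  p≢p⁻¹ (parity (suc n)) (trans (trans n+1∈p (sym n∈p)) (sym (suc-homo-⁻¹ n)))

nonconsecutive-∈ : ∀ (𝒰 : Ultrafilter) → ∃ λ (X : Subset) → X ⊥ suc-image X × mem 𝒰 X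
nonconsecutive-∈ 𝒰 with ultra 𝒰 (parity-class 0ℙ)
... | inj₁ evens∈𝒰 = parity-class 0ℙ , (λ {n} → parity-class-nonconsecutive 0ℙ {n}) , evens∈𝒰
... | inj₂ ∁evens∈𝒰 = parity-class 1ℙ , (λ {n} → parity-class-nonconsecutive 1ℙ {n}) , odds∈𝒰
  where
  ∁evens⊆odds : ∁ (parity-class 0ℙ) ⊆ parity-class 1ℙ
  ∁evens⊆odds {n} n∉evens with parity n
  ... | 0ℙ = ⊥-elim (n∉evens refl)
  ... | 1ℙ = refl

  odds∈𝒰 : mem 𝒰 (parity-class 1ℙ)
  odds∈𝒰 = upward 𝒰 (λ {n} → ∁evens⊆odds {n}) ∁evens∈𝒰

theorem12 : (𝒰 𝒱 : Ultrafilter) → 𝒰 ≤feᵤ 𝒱 → 𝒱 ≤feᵤ (𝒰 ⊕1) →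
            (𝒰 ≡feᵤ 𝒱) ⊎ ((𝒰 ⊕1) ≡feᵤ 𝒱)
theorem12 𝒰 𝒱 𝒰≤𝒱 𝒱≤𝒰⊕1 with nonconsecutive-∈ 𝒰
... | X , X⊥X+1 , X∈𝒰 with ultra 𝒱 X
...   | inj₁ X∈𝒱  = inj₁ (𝒰≤𝒱 , ≤feᵤ-⊕1⇒≤feᵤ 𝒰 𝒱 X⊥X+1 X∈𝒰 X∈𝒱 𝒱≤𝒰⊕1)
...   | inj₂ ∁X∈𝒱 = inj₂ (≤feᵤ⇒⊕1-≤feᵤ 𝒰 𝒱 X∈𝒰 ∁X∈𝒱 𝒰≤𝒱 , 𝒱≤𝒰⊕1)
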